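{- Let $(c_1',\dots,c_k')$ be a tuple satisfying $\mathcal R$ that minimizes $\sum_{i=1}^k\Phi(c_i',X_i')$ among all tuples satisfying $\mathcal R$. Then \[ \sum_{j=1}^k\Phi(c_j',X_j')\le OPT+\sum_{j\in I_s}\Phi(B,X_j)+\sum_{j\in I_l}\bar n_jR_j . \]
   Context: $\mathcal H$ is Hamming distance on $\{0,1\}^d$. Let $X\subseteq\{0,1\}^d$ be a set of $n$ points, $k\ge1$, $\mathcal R=\{R_1,\dots,R_d\}$ with $R_i\subseteq\{0,1\}^k$; a tuple $(c_1,\dots,c_k)$ of points of $\{0,1\}^d$ satisfies $\mathcal R$ if $(c_1[i],\dots,c_k[i])\in R_i$ for every coordinate $i$. For a center set $C$ and multiset $Y$, $\Phi(C,Y)=\sum_{y\in Y}\min_{c\in C}\mathcal H(y,c)$ (counting multiplicity), and $\Phi(c,Y)=\Phi(\{c\},Y)$. $OPT$ is the minimum of $\Phi(C,X)$ over tuples $C$ satisfying $\mathcal R$; $OPT^\star$ is the minimum of $\Phi(C,X)$ over sets $C$ of $k$ points of $\{0,1\}^d$. Fix $0<\varepsilon\le\frac12$ and let $B$ be a set of $k$ points of $\{0,1\}^d$ with $\Phi(B,X)\le\alpha\cdot OPT^\star$. For $x\in X$ let $n(x)$ be a point of $B$ nearest to $x$. Let $(c_1,\dots,c_k)$ satisfy $\mathcal R$ with $\Phi(\{c_1,\dots,c_k\},X)=OPT$, let $X_j$ be the set of $x\in X$ whose nearest center among $c_1,\dots,c_k$ is $c_j$ (ties broken arbitrarily, so the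 $X_j$ partition $X$). Let $I_s=\{j:\Phi(B,X_j)\le\frac{\varepsilon}{6\alpha k}\Phi(B,X)\}$ and $I_l=\{j:\Phi(B,X_j)>\frac{\varepsilon}{6\alpha k}\Phi(B,X)\}$. For $j\in I_l$: $R_j=\frac\varepsilon9\cdot\frac{\Phi(B,X_j)}{|X_j|}$, $X_j^{near}=\{x\in X_j:\min_{b\in B}\mathcal H(x,b)\le R_j\}$, $X_j^{far}=X_j\setminus X_j^{near}$, $\bar n_j=|X_j^{near}|$. Define multisets $X_j'=\{n(x):x\in X_j\}$ for $j\in I_s$, and $X_j'=X_j^{far}\cup\{n(x):x\in X_j^{near}\}$ for $j\in I_l$ (one copy of $n(x)$ per $x$).
   Formalization: The parameters ε and α are taken in the rationals. -}

module Defs where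

open import Data.Bool using (Bool; true; false; if_then_else_)
open import Data.Nat as ℕ using (ℕ; zero; suc; _⊓_)
open import Data.Fin as Fin using (Fin)
open import Data.Vec using (Vec; lookup; tabulate)
open import Data.List using (List; map; filter; allFin; length)
import Data.List as L
open import Data.Nat.ListAction renaming (sum to sumℕ)
open import Data.Integer using (+_)
open import Data.Rational as ℚ using (ℚ; 0ℚ; _+_; _*_; _÷_; _≤_; ≢-nonZero)
import Data.Rational.Properties as ℚP
open import Relation.Nullary using (yes; no; ¬_)
open import Relation.Nullary.Decidable using (does)
open import Relation.Unary using (Pred)
open import Level using (0ℓ)

Point : ℕ → Set
Point d = Vec Bool d

H : ∀ {d} → Point d → Point d → ℕ
H {d} x y = sumℕ (map (λ i → if does (lookup x i Data.Bool.≟ lookup y i) then 0 else 1) (allFin d))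
  where import Data.Bool

-- minimum of a function over Fin k (only used for k ≥ 1)
minFin : (k : ℕ) → (Fin k → ℕ) → ℕ
minFin zero f = 0
minFin (suc zero) f = f Fin.zero
minFin (suc (suc k)) f = f Fin.zero ⊓ minFin (suc k) (λ i → f (Fin.suc i))

distC : ∀ {d k} → Point d → (Fin k → Point d) → ℕ
distC {k = k} y C = minFin k (λ j → H y (C j))

-- Φ(C, Y), Y a multiset given as a list
Φ : ∀ {d k} → (Fin k → Point d) → List (Point d) → ℕ
Φ C Y = sumℕ (map (λ y → distC y C) Y)

Φ₁ : ∀ {d} → Point d → List (Point d) → ℕ
Φ₁ c Y = Φ {k = 1} (λ _ → c) Y

Satisfies : ∀ {d k} → (Fin d → Pred (Vec Bool k) 0ℓ) → (Fin k → Point d) → Set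
Satisfies {d} {k} R C = (i : Fin d) → R i (tabulate (λ j → lookup (C j) i))

ι : ℕ → ℚ
ι m = + m ℚ./ 1

-- division p / q; the convention for q = 0 is never used in the lemma
_div_ : ℚ → ℚ → ℚ
p div q with q ℚP.≟ 0ℚ
... | yes _ = 0ℚ
... | no q≢0 = _÷_ p q {{≢-nonZero q≢0}}

sumℚ : List ℚ → ℚ
sumℚ = L.foldr _+_ 0ℚ

pts : ∀ {d n} → (Fin n → Point d) → List (Point d)
pts {n = n} X = map X (allFin n)

-- The construction of the lemma, for data
--  X : the n points, B : the k points of the approximate solution,
--  ν x : index of a nearest point of B to X x  (n(x) = B (ν x)),
--  σ x : index j with X x ∈ X_j (nearest optimal center),
--  ε, α.
module Setup {d k n : ℕ} (X : Fin n → Point d) (B : Fin k → Point d)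
             (ν : Fin n → Fin k) (σ : Fin n → Fin k) (ε α : ℚ) where

  Xall : List (Point d)
  Xall = pts X

  idx : Fin k → List (Fin n)
  idx j = filter (λ x → σ x Fin.≟ j) (allFin n)

  Xc : Fin k → List (Point d)
  Xc j = map X (idx j)

  thr : ℚ
  thr = (ε div (ι 6 * α * ι k)) * ι (Φ B Xall)

  InIs : Fin k → Set
  InIs j = ι (Φ B (Xc j)) ≤ thr

  Is : List (Fin k)
  Is = filter (λ j → ι (Φ B (Xc j)) ℚP.≤? thr) (allFin k)

  Il : List (Fin k)
  Il = filter (λ j → Relation.Nullary.¬? (ι (Φ B (Xc j)) ℚP.≤? thr)) (allFin k)
    where import Relation.Nullary

  Rad : Fin k → ℚ
  Rad j = (ε div ι 9) * (ι (Φ B (Xc j)) div ι (length (Xc j)))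

  nearIdx : Fin k → List (Fin n)
  nearIdx j = filter (λ x → ι (distC (X x) B) ℚP.≤? Rad j) (idx j)

  nbar : Fin k → ℕ
  nbar j = length (nearIdx j)

  img : Fin n → Point d
  img x =
    if does (ι (Φ B (Xc (σ x))) ℚP.≤? thr) then B (ν x)
    else (if does (ι (distC (X x) B) ℚP.≤? Rad (σ x)) then B (ν x) else X x)

  Xp : Fin k → List (Point d)
  Xp j = map img (idx j)

  cost' : (Fin k → Point d) → ℕ
  cost' C = sumℕ (map (λ j → Φ₁ (C j) (Xp j)) (allFin k))

module Submission where

open import Defs
open import Data.Bool using (Bool; true; false; if_then_else_)
open import Data.Nat as ℕ using (ℕ; suc)
open import Data.Fin using (Fin)
open import Data.Vec using (Vec; lookup)
open import Data.List using (List; []; _∷_; map; filter; length; allFin)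
open import Data.Nat.ListAction renaming (sum to sumℕ)
open import Data.Integer using (+_)
open import Data.Rational as ℚ using (ℚ; 0ℚ; _+_; _*_; _≤_; _<_; mkℚ)
open import Relation.Unary using (Pred; Decidable)
open import Function.Definitions using (Injective)
open import Relation.Binary.PropositionalEquality
  using (_≡_; refl; sym; trans; cong; cong₂; subst₂; module ≡-Reasoning)
open import Level using (0ℓ)

open import Algebra.Bundles using (CommutativeMonoid)
import Algebra.Properties.CommutativeSemigroup as CommSemigroupProperties
import Data.Bool as Bool
import Data.Fin as Fin
import Data.Integer as ℤ
import Data.Integer.Properties as ℤP
import Data.List.Properties as ListP
open import Data.List.Relation.Unary.All as All using (All; []; _∷_)
open import Data.List.Relation.Unary.All.Properties using (all-filter)
open import Data.Nat.Coprimality using (gcd≡1⇒coprime)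
open import Data.Nat.GCD using (gcd-zeroʳ)
import Data.Nat.Properties as ℕP
import Data.Rational.Properties as ℚP
open import Function using (_∘_)
open import Relation.Nullary using (Dec; yes; no; ¬_; ¬?)
open import Relation.Nullary.Decidable using (does; dec-true; dec-false)

-- Compare the rounded instance with the optimal constrained solution c: since c' is optimal for
-- the rounded instance, cost'(c') ≤ cost'(c).  Moving a point x of X_j to n(x) changes its
-- distance to c_j by at most H(x, n(x)) = dist(x, B).  For a small cluster these displacements sum
-- to Φ(B, X_j); in a large cluster only the n̄_j near points move, each by at most R_j.  Summing
-- H(x, c_j) over the clusters X_j gives OPT.

ι-normal : ∀ m → ι m ≡ mkℚ (+ m) 0 (gcd≡1⇒coprime (gcd-zeroʳ m))
ι-normal m = ℚP.normalize-coprime _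

ι-homo-+ : ∀ m n → ι (m ℕ.+ n) ≡ ι m + ι n
ι-homo-+ m n rewrite ι-normal m | ι-normal n =
  cong (ℚ._/ 1) (sym (cong₂ ℤ._+_ (ℤP.*-identityʳ (+ m)) (ℤP.*-identityʳ (+ n))))

ι-mono-≤ : ∀ {m n} → m ℕ.≤ n → ι m ≤ ι n
ι-mono-≤ {m} {n} m≤n rewrite ι-normal m | ι-normal n =
  ℚ.*≤* (subst₂ ℤ._≤_ (sym (ℤP.*-identityʳ (+ m))) (sym (ℤP.*-identityʳ (+ n))) (ℤ.+≤+ m≤n))

ι-suc-* : ∀ m r → ι (suc m) * r ≡ r + ι m * r
ι-suc-* m r = begin
  ι (1 ℕ.+ m) * r      ≡⟨ cong (_* r) (ι-homo-+ 1 m) ⟩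
  (ι 1 + ι m) * r      ≡⟨ ℚP.*-distribʳ-+ r (ι 1) (ι m) ⟩
  ι 1 * r + ι m * r    ≡⟨ cong (_+ ι m * r) (ℚP.*-identityˡ r) ⟩
  r + ι m * r          ∎
  where open ≡-Reasoning

module ℕ+ = CommSemigroupProperties ℕP.+-commutativeSemigroup
module ℚ+ = CommSemigroupProperties (CommutativeMonoid.commutativeSemigroup ℚP.+-0-commutativeMonoid)

module _ {A : Set} where

  sum-map-+ : (f g : A → ℕ) (xs : List A) →
              sumℕ (map (λ x → f x ℕ.+ g x) xs) ≡ sumℕ (map f xs) ℕ.+ sumℕ (map g xs)
  sum-map-+ f g []       = refl
  sum-map-+ f g (x ∷ xs) rewrite sum-map-+ f g xs = ℕ+.interchange (f x) (g x) _ _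

  sum-map-0 : (xs : List A) → sumℕ (map (λ _ → 0) xs) ≡ 0
  sum-map-0 []       = refl
  sum-map-0 (x ∷ xs) = sum-map-0 xs

  sum-map-mono-≤ : (f g : A → ℕ) (xs : List A) → All (λ x → f x ℕ.≤ g x) xs →
                   sumℕ (map f xs) ℕ.≤ sumℕ (map g xs)
  sum-map-mono-≤ f g []       []       = ℕ.z≤n
  sum-map-mono-≤ f g (x ∷ xs) (p ∷ ps) = ℕP.+-mono-≤ p (sum-map-mono-≤ f g xs ps)

  sum-map-filter-∷ : {P : Pred A 0ℓ} (P? : Decidable P) (f : A → ℕ) (x : A) (xs : List A) →
                     sumℕ (map f (filter P? (x ∷ xs)))
                       ≡ (if does (P? x) then f x else 0) ℕ.+ sumℕ (map f (filter P? xs))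
  sum-map-filter-∷ P? f x xs with P? x
  ... | yes _ = refl
  ... | no  _ = refl

  ι-sum : (f : A → ℕ) (xs : List A) → ι (sumℕ (map f xs)) ≡ sumℚ (map (ι ∘ f) xs)
  ι-sum f []       = refl
  ι-sum f (x ∷ xs) = trans (ι-homo-+ (f x) _) (cong (_+_ (ι (f x))) (ι-sum f xs))

  sumℚ-map-+ : (f g : A → ℚ) (xs : List A) →
               sumℚ (map (λ x → f x + g x) xs) ≡ sumℚ (map f xs) + sumℚ (map g xs)
  sumℚ-map-+ f g []       = refl
  sumℚ-map-+ f g (x ∷ xs) rewrite sumℚ-map-+ f g xs = ℚ+.interchange (f x) (g x) _ _

  sumℚ-map-mono-≤ : (f g : A → ℚ) (xs : List A) → All (λ x → f x ≤ g x) xs →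
                    sumℚ (map f xs) ≤ sumℚ (map g xs)
  sumℚ-map-mono-≤ f g []       []       = ℚP.≤-refl
  sumℚ-map-mono-≤ f g (x ∷ xs) (p ∷ ps) = ℚP.+-mono-≤ p (sumℚ-map-mono-≤ f g xs ps)

  sumℚ-map-if : {P : Pred A 0ℓ} (P? : Decidable P) (f g : A → ℚ) (xs : List A) →
                sumℚ (map (λ x → if does (P? x) then f x else g x) xs)
                  ≡ sumℚ (map f (filter P? xs)) + sumℚ (map g (filter (¬? ∘ P?) xs))
  sumℚ-map-if P? f g []       = refl
  sumℚ-map-if P? f g (x ∷ xs) with P? x
  ... | yes _ = trans (cong (_+_ (f x)) (sumℚ-map-if P? f g xs)) (sym (ℚP.+-assoc (f x) _ _))
  ... | no  _ = trans (cong (_+_ (g x)) (sumℚ-map-if P? f g xs))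
                      (ℚ+.x∙yz≈y∙xz (g x) (sumℚ (map f (filter P? xs))) (sumℚ (map g (filter (¬? ∘ P?) xs))))

  sumℚ-map-indicator : {P : Pred A 0ℓ} (P? : Decidable P) (r : ℚ) (xs : List A) →
                       sumℚ (map (λ x → if does (P? x) then r else 0ℚ) xs) ≡ ι (length (filter P? xs)) * r
  sumℚ-map-indicator P? r []       = sym (ℚP.*-zeroˡ r)
  sumℚ-map-indicator P? r (x ∷ xs) with P? x
  ... | yes _ = trans (cong (_+_ r) (sumℚ-map-indicator P? r xs)) (sym (ι-suc-* (length (filter P? xs)) r))
  ... | no  _ = trans (ℚP.+-identityˡ _) (sumℚ-map-indicator P? r xs)

map-allFin-suc : ∀ {A : Set} {k} (f : Fin (suc k) → A) →
                 map f (allFin (suc k)) ≡ f Fin.zero ∷ map (f ∘ Fin.suc) (allFin k)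
map-allFin-suc f = cong (f Fin.zero ∷_)
  (trans (ListP.map-tabulate Fin.suc f) (sym (ListP.map-tabulate (λ i → i) (f ∘ Fin.suc))))

sum-allFin-indicator : ∀ {k} (i : Fin k) (h : Fin k → ℕ) →
                       sumℕ (map (λ j → if does (i Fin.≟ j) then h j else 0) (allFin k)) ≡ h i
sum-allFin-indicator {suc k} Fin.zero h = begin
  sumℕ (map (λ j → if does (Fin.zero Fin.≟ j) then h j else 0) (allFin (suc k)))
    ≡⟨ cong sumℕ (map-allFin-suc (λ j → if does (Fin.zero Fin.≟ j) then h j else 0)) ⟩
  h Fin.zero ℕ.+ sumℕ (map (λ _ → 0) (allFin k))   ≡⟨ cong (h Fin.zero ℕ.+_) (sum-map-0 (allFin k)) ⟩
  h Fin.zero ℕ.+ 0                                  ≡⟨ ℕP.+-identityʳ (h Fin.zero) ⟩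
  h Fin.zero                                        ∎
  where open ≡-Reasoning
sum-allFin-indicator {suc k} (Fin.suc i) h =
  trans (cong sumℕ (map-allFin-suc (λ j → if does (Fin.suc i Fin.≟ j) then h j else 0)))
        (sum-allFin-indicator i (h ∘ Fin.suc))

sum-fibres : ∀ {A : Set} {k} (σ : A → Fin k) (g : A → Fin k → ℕ) (xs : List A) →
             sumℕ (map (λ j → sumℕ (map (λ x → g x j) (filter (λ x → σ x Fin.≟ j) xs))) (allFin k))
               ≡ sumℕ (map (λ x → g x (σ x)) xs)
sum-fibres {k = k} σ g []       = sum-map-0 (allFin k)
sum-fibres {k = k} σ g (x ∷ xs) = begin
  sumℕ (map (λ j → fibre j (x ∷ xs)) (allFin k))
    ≡⟨ cong sumℕ (ListP.map-cong (λ j → sum-map-filter-∷ (λ y → σ y Fin.≟ j) (λ y → g y j) x xs) (allFin k)) ⟩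
  sumℕ (map (λ j → (if does (σ x Fin.≟ j) then g x j else 0) ℕ.+ fibre j xs) (allFin k))
    ≡⟨ sum-map-+ (λ j → if does (σ x Fin.≟ j) then g x j else 0) (λ j → fibre j xs) (allFin k) ⟩
  sumℕ (map (λ j → if does (σ x Fin.≟ j) then g x j else 0) (allFin k)) ℕ.+ sumℕ (map (λ j → fibre j xs) (allFin k))
    ≡⟨ cong₂ ℕ._+_ (sum-allFin-indicator (σ x) (g x)) (sum-fibres σ g xs) ⟩
  g x (σ x) ℕ.+ sumℕ (map (λ y → g y (σ y)) xs) ∎
  where
  open ≡-Reasoning
  fibre : Fin k → List _ → ℕ
  fibre j ys = sumℕ (map (λ y → g y j) (filter (λ y → σ y Fin.≟ j) ys))

bitDist : Bool → Bool → ℕ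
bitDist a b = if does (a Bool.≟ b) then 0 else 1

bitDist-triangle : ∀ a b c → bitDist a c ℕ.≤ bitDist a b ℕ.+ bitDist b c
bitDist-triangle false false false = ℕ.z≤n
bitDist-triangle false false true  = ℕ.s≤s ℕ.z≤n
bitDist-triangle false true  false = ℕ.z≤n
bitDist-triangle false true  true  = ℕ.s≤s ℕ.z≤n
bitDist-triangle true  false false = ℕ.s≤s ℕ.z≤n
bitDist-triangle true  false true  = ℕ.z≤n
bitDist-triangle true  true  false = ℕ.s≤s ℕ.z≤n
bitDist-triangle true  true  true  = ℕ.z≤n

bitDist-sym : ∀ a b → bitDist a b ≡ bitDist b a
bitDist-sym false false = refl
bitDist-sym false true  = refl
bitDist-sym true  false = refl
bitDist-sym true  true  = refl

bitDist-self : ∀ a → bitDist a a ≡ 0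
bitDist-self false = refl
bitDist-self true  = refl

module _ {d : ℕ} where

  H-triangle : (x y z : Point d) → H x z ℕ.≤ H x y ℕ.+ H y z
  H-triangle x y z = ℕP.≤-trans
    (sum-map-mono-≤ (λ i → bitDist (x ! i) (z ! i)) (λ i → bitDist (x ! i) (y ! i) ℕ.+ bitDist (y ! i) (z ! i)) (allFin d)
      (All.tabulate (λ {i} _ → bitDist-triangle (x ! i) (y ! i) (z ! i))))
    (ℕP.≤-reflexive (sum-map-+ (λ i → bitDist (x ! i) (y ! i)) (λ i → bitDist (y ! i) (z ! i)) (allFin d)))
    where _!_ = lookup

  H-sym : (x y : Point d) → H x y ≡ H y x
  H-sym x y = cong sumℕ (ListP.map-cong (λ i → bitDist-sym (lookup x i) (lookup y i)) (allFin d))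

  H-self : (x : Point d) → H x x ≡ 0
  H-self x = trans (cong sumℕ (ListP.map-cong (λ i → bitDist-self (lookup x i)) (allFin d))) (sum-map-0 (allFin d))

-- The index i only witnesses k ≥ 1: minFin 0 f is the junk value 0.
minFin-greatest : ∀ {k} (i : Fin k) {m} (f : Fin k → ℕ) → (∀ j → m ℕ.≤ f j) → m ℕ.≤ minFin k f
minFin-greatest {suc ℕ.zero}  i f m≤f = m≤f Fin.zero
minFin-greatest {suc (suc k)} i f m≤f =
  ℕP.⊓-glb (m≤f Fin.zero) (minFin-greatest Fin.zero (f ∘ Fin.suc) (m≤f ∘ Fin.suc))

Φ₁-map-≤ : ∀ {d} {A : Set} (c : Point d) (f g : A → Point d) (xs : List A) →
           Φ₁ c (map f xs) ℕ.≤ Φ₁ c (map g xs) ℕ.+ sumℕ (map (λ x → H (f x) (g x)) xs)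
Φ₁-map-≤ c f g xs = begin
  Φ₁ c (map f xs)                                        ≡⟨ cong sumℕ (sym (ListP.map-∘ xs)) ⟩
  sumℕ (map (λ x → H (f x) c) xs)                        ≤⟨ sum-map-mono-≤ _ _ xs (All.tabulate (λ {x} _ → triangle x)) ⟩
  sumℕ (map (λ x → H (g x) c ℕ.+ H (f x) (g x)) xs)      ≡⟨ sum-map-+ (λ x → H (g x) c) _ xs ⟩
  sumℕ (map (λ x → H (g x) c) xs) ℕ.+ sumℕ (map (λ x → H (f x) (g x)) xs)
                                                         ≡⟨ cong (ℕ._+ _) (cong sumℕ (ListP.map-∘ xs)) ⟩
  Φ₁ c (map g xs) ℕ.+ sumℕ (map (λ x → H (f x) (g x)) xs) ∎
  where
  open ℕP.≤-Reasoning
  triangle : ∀ x → H (f x) c ℕ.≤ H (g x) c ℕ.+ H (f x) (g x)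
  triangle x = ℕP.≤-trans (H-triangle (f x) (g x) c) (ℕP.≤-reflexive (ℕP.+-comm (H (f x) (g x)) _))

module RoundedInstance {d k n : ℕ} (X : Fin n → Point d) (B : Fin k → Point d)
  (ν : Fin n → Fin k) (σ : Fin n → Fin k) (ε α : ℚ) (c : Fin k → Point d)
  (ν-nearest : (x : Fin n) (b : Fin k) → H (X x) (B (ν x)) ℕ.≤ H (X x) (B b))
  (σ-nearest : (x : Fin n) (j : Fin k) → H (X x) (c (σ x)) ℕ.≤ H (X x) (c j)) where

  open Setup X B ν σ ε α

  small? : Decidable InIs
  small? j = ι (Φ B (Xc j)) ℚP.≤? thr

  Near : Fin k → Fin n → Set
  Near j x = ι (distC (X x) B) ≤ Rad j

  near? : (j : Fin k) → Decidable (Near j)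
  near? j x = ι (distC (X x) B) ℚP.≤? Rad j

  idx-σ : ∀ j → All (λ x → σ x ≡ j) (idx j)
  idx-σ j = all-filter (λ x → σ x Fin.≟ j) (allFin n)

  image-in-large-cluster : Fin n → Point d
  image-in-large-cluster x = if does (near? (σ x) x) then B (ν x) else X x

  img-small : ∀ x → InIs (σ x) → img x ≡ B (ν x)
  img-small x s = cong (λ b → if b then B (ν x) else image-in-large-cluster x) (dec-true (small? (σ x)) s)

  img-large : ∀ x → ¬ InIs (σ x) → img x ≡ image-in-large-cluster x
  img-large x l = cong (λ b → if b then B (ν x) else image-in-large-cluster x) (dec-false (small? (σ x)) l)

  img-near : ∀ x → ¬ InIs (σ x) → Near (σ x) x → img x ≡ B (ν x)
  img-near x l nr =
    trans (img-large x l) (cong (λ b → if b then B (ν x) else X x) (dec-true (near? (σ x) x) nr))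

  img-far : ∀ x → ¬ InIs (σ x) → ¬ Near (σ x) x → img x ≡ X x
  img-far x l fr =
    trans (img-large x l) (cong (λ b → if b then B (ν x) else X x) (dec-false (near? (σ x) x) fr))

  displacement : Fin n → ℕ
  displacement x = H (img x) (X x)

  displacement-moved : ∀ x → img x ≡ B (ν x) → displacement x ℕ.≤ distC (X x) B
  displacement-moved x moved = begin
    H (img x) (X x)      ≡⟨ cong (λ p → H p (X x)) moved ⟩
    H (B (ν x)) (X x)    ≡⟨ H-sym (B (ν x)) (X x) ⟩
    H (X x) (B (ν x))    ≤⟨ minFin-greatest (ν x) _ (ν-nearest x) ⟩
    distC (X x) B        ∎
    where open ℕP.≤-Reasoning

  displacement-small : ∀ {j} → InIs j → ∀ {x} → σ x ≡ j → displacement x ℕ.≤ distC (X x) B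
  displacement-small s {x} refl = displacement-moved x (img-small x s)

  displacement-large : ∀ {j} → ¬ InIs j → ∀ {x} → σ x ≡ j →
                       ι (displacement x) ≤ (if does (near? j x) then Rad j else 0ℚ)
  displacement-large l {x} refl = bound (near? (σ x) x)
    where
    bound : (nr? : Dec (Near (σ x) x)) → ι (displacement x) ≤ (if does nr? then Rad (σ x) else 0ℚ)
    bound (yes nr) = ℚP.≤-trans {ι (displacement x)} {ι (distC (X x) B)} {Rad (σ x)}
                                (ι-mono-≤ (displacement-moved x (img-near x l nr))) nr
    bound (no  fr) = ℚP.≤-reflexive (cong ι (trans (cong (λ p → H p (X x)) (img-far x l fr)) (H-self (X x))))

  budget : Fin k → ℚ
  budget j = if does (small? j) then ι (Φ B (Xc j)) else ι (nbar j) * Rad j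

  cluster-displacement≤budget : ∀ j → ι (sumℕ (map displacement (idx j))) ≤ budget j
  cluster-displacement≤budget j = bound (small? j)
    where
    bound : (s? : Dec (InIs j)) →
            ι (sumℕ (map displacement (idx j))) ≤ (if does s? then ι (Φ B (Xc j)) else ι (nbar j) * Rad j)
    bound (yes s) = ι-mono-≤ (begin
      sumℕ (map displacement (idx j))
        ≤⟨ sum-map-mono-≤ _ _ (idx j) (All.map (displacement-small s) (idx-σ j)) ⟩
      sumℕ (map (λ x → distC (X x) B) (idx j))    ≡⟨ cong sumℕ (ListP.map-∘ (idx j)) ⟩
      Φ B (Xc j)                                  ∎)
      where open ℕP.≤-Reasoning
    bound (no l) = begin
      ι (sumℕ (map displacement (idx j)))         ≡⟨ ι-sum displacement (idx j) ⟩
      sumℚ (map (ι ∘ displacement) (idx j))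
        ≤⟨ sumℚ-map-mono-≤ (ι ∘ displacement) (λ x → if does (near? j x) then Rad j else 0ℚ) (idx j)
                           (All.map (displacement-large l) (idx-σ j)) ⟩
      sumℚ (map (λ x → if does (near? j x) then Rad j else 0ℚ) (idx j))
                                                  ≡⟨ sumℚ-map-indicator (near? j) (Rad j) (idx j) ⟩
      ι (nbar j) * Rad j                          ∎
      where open ℚP.≤-Reasoning

  cluster-cost≤ : ∀ j → ι (Φ₁ (c j) (Xp j)) ≤ ι (Φ₁ (c j) (Xc j)) + budget j
  cluster-cost≤ j = begin
    ι (Φ₁ (c j) (Xp j))
      ≤⟨ ι-mono-≤ (Φ₁-map-≤ (c j) img X (idx j)) ⟩
    ι (Φ₁ (c j) (Xc j) ℕ.+ sumℕ (map displacement (idx j)))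
      ≡⟨ ι-homo-+ (Φ₁ (c j) (Xc j)) (sumℕ (map displacement (idx j))) ⟩
    ι (Φ₁ (c j) (Xc j)) + ι (sumℕ (map displacement (idx j)))
      ≤⟨ ℚP.+-monoʳ-≤ (ι (Φ₁ (c j) (Xc j))) (cluster-displacement≤budget j) ⟩
    ι (Φ₁ (c j) (Xc j)) + budget j ∎
    where open ℚP.≤-Reasoning

  clusters-cost≤Φ : sumℕ (map (λ j → Φ₁ (c j) (Xc j)) (allFin k)) ℕ.≤ Φ c (pts X)
  clusters-cost≤Φ = begin
    sumℕ (map (λ j → Φ₁ (c j) (Xc j)) (allFin k))
      ≡⟨ cong sumℕ (ListP.map-cong (λ j → cong sumℕ (sym (ListP.map-∘ (idx j)))) (allFin k)) ⟩
    sumℕ (map (λ j → sumℕ (map (λ x → H (X x) (c j)) (idx j))) (allFin k))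
      ≡⟨ sum-fibres σ (λ x j → H (X x) (c j)) (allFin n) ⟩
    sumℕ (map (λ x → H (X x) (c (σ x))) (allFin n))
      ≤⟨ sum-map-mono-≤ (λ x → H (X x) (c (σ x))) (λ x → distC (X x) c) (allFin n)
                        (All.tabulate (λ {x} _ → minFin-greatest (σ x) _ (σ-nearest x))) ⟩
    sumℕ (map (λ x → distC (X x) c) (allFin n))
      ≡⟨ cong sumℕ (ListP.map-∘ (allFin n)) ⟩
    Φ c (pts X) ∎
    where open ℕP.≤-Reasoning

  cost'-optimum≤ : ι (cost' c) ≤ ι (Φ c (pts X)) + ι (sumℕ (map (λ j → Φ B (Xc j)) Is))
                                 + sumℚ (map (λ j → ι (nbar j) * Rad j) Il)
  cost'-optimum≤ = begin
    ι (cost' c)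
      ≡⟨ ι-sum (λ j → Φ₁ (c j) (Xp j)) (allFin k) ⟩
    sumℚ (map (λ j → ι (Φ₁ (c j) (Xp j))) (allFin k))
      ≤⟨ sumℚ-map-mono-≤ (λ j → ι (Φ₁ (c j) (Xp j))) (λ j → ι (Φ₁ (c j) (Xc j)) + budget j) (allFin k)
                         (All.tabulate (λ {j} _ → cluster-cost≤ j)) ⟩
    sumℚ (map (λ j → ι (Φ₁ (c j) (Xc j)) + budget j) (allFin k))
      ≡⟨ sumℚ-map-+ (λ j → ι (Φ₁ (c j) (Xc j))) budget (allFin k) ⟩
    sumℚ (map (λ j → ι (Φ₁ (c j) (Xc j))) (allFin k)) + sumℚ (map budget (allFin k))
      ≡⟨ cong₂ _+_ (sym (ι-sum (λ j → Φ₁ (c j) (Xc j)) (allFin k)))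
                   (sumℚ-map-if small? (λ j → ι (Φ B (Xc j))) (λ j → ι (nbar j) * Rad j) (allFin k)) ⟩
    ι (sumℕ (map (λ j → Φ₁ (c j) (Xc j)) (allFin k))) + (ΣIs + ΣIl)
      ≤⟨ ℚP.+-monoˡ-≤ (ΣIs + ΣIl) (ι-mono-≤ clusters-cost≤Φ) ⟩
    ι (Φ c (pts X)) + (ΣIs + ΣIl)
      ≡⟨ sym (ℚP.+-assoc (ι (Φ c (pts X))) ΣIs ΣIl) ⟩
    ι (Φ c (pts X)) + ΣIs + ΣIl
      ≡⟨ cong (λ s → ι (Φ c (pts X)) + s + ΣIl) (sym (ι-sum (λ j → Φ B (Xc j)) Is)) ⟩
    ι (Φ c (pts X)) + ι (sumℕ (map (λ j → Φ B (Xc j)) Is)) + ΣIl ∎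
    where
    open ℚP.≤-Reasoning
    ΣIs = sumℚ (map (λ j → ι (Φ B (Xc j))) Is)
    ΣIl = sumℚ (map (λ j → ι (nbar j) * Rad j) Il)

lemma4 : (d k n : ℕ) → 1 ℕ.≤ k
    → (X : Fin n → Point d) → Injective _≡_ _≡_ X
    → (R : Fin d → Pred (Vec Bool k) 0ℓ)
    → (ε α : ℚ) → 0ℚ < ε → ε ≤ (+ 1 ℚ./ 2) → 0ℚ < α
    → (B : Fin k → Point d) → Injective _≡_ _≡_ B
    → ((C : Fin k → Point d) → Injective _≡_ _≡_ C → ι (Φ B (pts X)) ≤ α * ι (Φ C (pts X)))
    → (ν : Fin n → Fin k) → ((x : Fin n) (b : Fin k) → H (X x) (B (ν x)) ℕ.≤ H (X x) (B b))
    → (c : Fin k → Point d) → Satisfies R c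
    → ((C : Fin k → Point d) → Satisfies R C → Φ c (pts X) ℕ.≤ Φ C (pts X))
    → (σ : Fin n → Fin k) → ((x : Fin n) (j : Fin k) → H (X x) (c (σ x)) ℕ.≤ H (X x) (c j))
    → (c' : Fin k → Point d) → Satisfies R c'
    → ((C : Fin k → Point d) → Satisfies R C → Setup.cost' X B ν σ ε α c' ℕ.≤ Setup.cost' X B ν σ ε α C)
    → ι (Setup.cost' X B ν σ ε α c')
      ≤ ι (Φ c (pts X))
        + ι (sumℕ (map (λ j → Φ B (Setup.Xc X B ν σ ε α j)) (Setup.Is X B ν σ ε α)))
        + sumℚ (map (λ j → ι (Setup.nbar X B ν σ ε α j) * Setup.Rad X B ν σ ε α j) (Setup.Il X B ν σ ε α))
lemma4 d k n _ X _ R ε α _ _ _ B _ _ ν ν-nearest c c-sat _ σ σ-nearest c' _ c'-optimal =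
  ℚP.≤-trans (ι-mono-≤ (c'-optimal c c-sat)) (cost'-optimum≤ X B ν σ ε α c ν-nearest σ-nearest)
  where open RoundedInstance using (cost'-optimum≤)
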